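{- A dessin $\mathcal D\in GP(n,p,c)$ is invariant (up to isomorphism) under all six operations $\mathcal D\mapsto\mathcal D$, $\mathcal D^{01}$, $\mathcal D^{02}$, $\mathcal D^{12}$, $\mathcal D^{012}$, $\mathcal D^{210}$ if and only if $n=3$ and $c=1$.
   Context: A regular dessin is determined up to isomorphism by a triple $(G;x,y)$ with $G$ a finite group generated by $x,y$; $(G;x,y)$ and $(G';x',y')$ give isomorphic dessins iff some isomorphism $G\to G'$ sends $x\mapsto x'$, $y\mapsto y'$. Put $z=(xy)^{ -1}$. The duality and triality operations: $\mathcal D^{01}$ is given by $(G;y,x)$, $\mathcal D^{12}$ by $(G;x,z)$, $\mathcal D^{02}$ by $(G;z,y)$, $\mathcal D^{012}$ by $(G;y,z)$ and $\mathcal D^{210}$ by $(G;z,x)$. Generalised Paley dessins: let $p$ be prime, $d\ge1$, $q=p^d$. Let ${\rm AGL}_1(q)$ be the group of maps $t\mapsto at+b$ of ${\mathbb F}_q$ ($a\ne0$), $T=\{t\mapsto t+b\}$. For a subgroup $S\le{\mathbb F}_q^*$ of order $n$ (identified with $\{t\mapsto at:a\in S\}$), $G_S=T\rtimes S$, where either $n=d=1$, or $n>1$ and $p$ has multiplicative order $d$ mod $n$. For $x$ a generator of $S$ and $y\in G_S\setminus S$, the regular dessin $(G_S;x,y)$ is a generalised Paley dessin with valency $n$ and characteristic $p$; its colour constant is the unique $c\in{\mathbb Z}_n$ with $y\in Tx^c$. $GP(n,p,c)$ is the set of isomorphism classes of these with colour constant $c$. -}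

module Defs where

open import Level using (0ℓ)
open import Data.Nat using (ℕ; zero; suc; _≤_; _<_; _^_; _∸_)
open import Data.Nat.Divisibility using (_∣_)
open import Data.Fin using (Fin)
open import Data.Product using (Σ; ∃; _×_; _,_; proj₁; proj₂)
open import Data.Sum using (_⊎_)
open import Relation.Nullary using (¬_)
open import Relation.Binary.PropositionalEquality using (_≡_; _≢_)
open import Algebra.Structures using (IsCommutativeRing)
open import Function.Bundles using (_↔_)

record FiniteField (q : ℕ) : Set₁ where
  infixl 6 _+_
  infixl 7 _*_
  field
    Carrier    : Set
    _+_ _*_    : Carrier → Carrier → Carrier
    -_         : Carrier → Carrier
    0# 1#      : Carrier
    _⁻¹        : Carrier → Carrier
    isCommutativeRing : IsCommutativeRing _≡_ _+_ _*_ -_ 0# 1#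
    0≢1        : 0# ≢ 1#
    ⁻¹-inverse : ∀ a → a ≢ 0# → a * (a ⁻¹) ≡ 1#
    enumerate  : Fin q ↔ Carrier

ModOrder : ℕ → ℕ → ℕ → Set
ModOrder p n d = (1 ≤ d) × (n ∣ (p ^ d ∸ 1)) × (∀ k → 1 ≤ k → k < d → ¬ (n ∣ (p ^ k ∸ 1)))

AdmissibleParams : ℕ → ℕ → ℕ → Set
AdmissibleParams n p d = (n ≡ 1 × d ≡ 1) ⊎ (1 < n × ModOrder p n d)

module AffineGroup {q : ℕ} (F : FiniteField q) where
  open FiniteField F

  pow : Carrier → ℕ → Carrier
  pow a zero    = 1#
  pow a (suc k) = a * pow a k

  HasOrder : Carrier → ℕ → Set
  HasOrder a n = (1 ≤ n) × (pow a n ≡ 1#) × (∀ k → 1 ≤ k → k < n → pow a k ≢ 1#)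

  -- (a , b) represents the affine map t ↦ a t + b
  Aff : Set
  Aff = Carrier × Carrier

  -- composition of maps: (g ∘ₐ h)(t) = g (h t)
  _∘ₐ_ : Aff → Aff → Aff
  (a , b) ∘ₐ (a' , b') = (a * a' , a * b' + b)

  invₐ : Aff → Aff
  invₐ (a , b) = (a ⁻¹ , - (a ⁻¹ * b))

  lin : Carrier → Aff
  lin a = (a , 0#)

  trans : Carrier → Aff
  trans b = (1# , b)

  module _ (x : Carrier) where
    InS : Carrier → Set
    InS a = ∃ λ k → pow x k ≡ a

    InSAff : Aff → Set
    InSAff g = InS (proj₁ g) × proj₂ g ≡ 0#

    -- G_S = T ⋊ S
    InG : Aff → Set
    InG g = InS (proj₁ g)

    IsAutomorphism : (Aff → Aff) → Set
    IsAutomorphism φ =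
      (∀ g → InG g → InG (φ g)) ×
      (∀ g h → InG g → InG h → φ (g ∘ₐ h) ≡ φ g ∘ₐ φ h) ×
      (∀ g h → InG g → InG h → φ g ≡ φ h → g ≡ h) ×
      (∀ h → InG h → ∃ λ g → InG g × φ g ≡ h)

    DessinIso : Aff × Aff → Aff × Aff → Set
    DessinIso (u , v) (u' , v') = ∃ λ φ → IsAutomorphism φ × φ u ≡ u' × φ v ≡ v'

    ColourConstant : {n : ℕ} → Aff → Fin n → Set
    ColourConstant y c = ∃ λ b → y ≡ trans b ∘ₐ lin (pow x (Data.Fin.toℕ c))

    InvariantUnderAll : Aff → Set
    InvariantUnderAll y =
      let X = lin x
          Z = invₐ (X ∘ₐ y)
      in DessinIso (X , y) (X , y) ×
         DessinIso (X , y) (y , X) ×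
         DessinIso (X , y) (Z , y) ×
         DessinIso (X , y) (X , Z) ×
         DessinIso (X , y) (y , Z) ×
         DessinIso (X , y) (Z , X)

{-# OPTIONS --safe #-}
module Submission where

-- An automorphism of G_S maps translations to translations (a non-translation never commutes with
-- its conjugate by t ↦ t + 1), so it acts on linear parts through G_S → S. As y ∈ T x^c and
-- z ∈ T x^(-1-c), invariance under D^01 gives x^(c²) = x and invariance under D^12 gives
-- x^c = x^(-1-c); together x³ = 1, so n = 3 and c = 1 (n = 1 is excluded by y ∉ S). Conversely,
-- for n = 3 and c = 1 the elements x, y, z lie in the coset T x with pairwise distinct translation
-- parts, and any two such pairs are exchanged by conjugation with an affine map, which
-- normalises G_S.

open import Defs
open import Data.Nat using (ℕ; _≤_; _^_)
open import Data.Nat.Primality using (Prime)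
open import Data.Fin using (Fin; toℕ)
open import Data.Product using (_×_)
open import Relation.Nullary using (¬_)
open import Relation.Binary.PropositionalEquality using (_≡_)
open import Function.Bundles using (_⇔_)

open import Level using (0ℓ)
open import Data.Nat as ℕ using (zero; suc; _<_; s≤s; z≤n)
import Data.Nat.Properties as ℕ
open import Data.Nat.Tactic.RingSolver using (solve-∀)
open import Data.Integer as ℤ using (ℤ; +_; -[1+_]; _⊖_; _◃_)
import Data.Integer.Properties as ℤ
open import Data.Sign as Sign using ()
open import Data.Maybe as Maybe using ()
import Data.Fin as Fin
open import Data.Fin.Properties using (toℕ<n)
open import Data.Product using (∃; _,_; proj₁; proj₂)
open import Data.Empty using (⊥-elim)
open import Relation.Nullary using (yes; no)
open import Relation.Nullary.Decidable using (map′; dec⇒maybe)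
open import Relation.Binary.Definitions using (DecidableEquality)
open import Relation.Binary.PropositionalEquality as Eq using (_≢_; refl; cong; cong₂; subst)
open import Function.Base using (_∘_)
open import Function.Bundles using (Inverse; mk⇔)
open import Algebra.Bundles using (CommutativeRing)
import Algebra.Solver.Ring.AlmostCommutativeRing as ACR

-- The reflective solver cannot cancel coefficients of an abstract ring, so equalities are solved
-- with integer coefficients, interpreted through the canonical map ι : ℤ → R.
module IntegerCoefficientSolver {c ℓ} (R : CommutativeRing c ℓ) where
  open CommutativeRing R renaming (refl to ≈-refl)
  open import Algebra.Properties.Monoid.Mult.TCOptimised +-monoid using (1+×; ×-homo-+)
    renaming (_×_ to _×ᴿ_)
  open import Algebra.Properties.Semiring.Mult.TCOptimised semiring using (×1-homo-*)
  open import Algebra.Properties.Ring ring using (-‿distribˡ-*; -‿distribʳ-*)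
  open import Algebra.Properties.AbelianGroup +-abelianGroup using (⁻¹-∙-comm)
  open import Algebra.Properties.Group +-group using (ε⁻¹≈ε; ⁻¹-involutive)
  open import Relation.Binary.Reasoning.Setoid setoid

  ι : ℤ → Carrier
  ι (+ n)    = n ×ᴿ 1#
  ι -[1+ n ] = - (suc n ×ᴿ 1#)

  private
    1+a-[1+b]≈a-b : ∀ a b → (1# + a) - (1# + b) ≈ a - b
    1+a-[1+b]≈a-b a b = begin
      (1# + a) + - (1# + b)     ≈⟨ +-congˡ (⁻¹-∙-comm 1# b) ⟨
      (1# + a) + (- 1# + - b)   ≈⟨ +-assoc 1# a (- 1# + - b) ⟩
      1# + (a + (- 1# + - b))   ≈⟨ +-congˡ (+-assoc a (- 1#) (- b)) ⟨
      1# + ((a + - 1#) + - b)   ≈⟨ +-congˡ (+-congʳ (+-comm a (- 1#))) ⟩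
      1# + ((- 1# + a) + - b)   ≈⟨ +-congˡ (+-assoc (- 1#) a (- b)) ⟩
      1# + (- 1# + (a + - b))   ≈⟨ +-assoc 1# (- 1#) (a - b) ⟨
      (1# + - 1#) + (a + - b)   ≈⟨ +-congʳ (-‿inverseʳ 1#) ⟩
      0# + (a + - b)            ≈⟨ +-identityˡ (a - b) ⟩
      a - b                     ∎

    ι-⊖ : ∀ m n → ι (m ⊖ n) ≈ m ×ᴿ 1# - n ×ᴿ 1#
    ι-⊖ zero    zero    = sym (trans (+-identityˡ (- 0#)) ε⁻¹≈ε)
    ι-⊖ (suc m) zero    = sym (trans (+-congˡ ε⁻¹≈ε) (+-identityʳ _))
    ι-⊖ zero    (suc n) = sym (+-identityˡ _)
    ι-⊖ (suc m) (suc n) = begin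
      ι (suc m ⊖ suc n)         ≡⟨ cong ι (ℤ.[1+m]⊖[1+n]≡m⊖n m n) ⟩
      ι (m ⊖ n)                 ≈⟨ ι-⊖ m n ⟩
      m ×ᴿ 1# - n ×ᴿ 1#           ≈⟨ 1+a-[1+b]≈a-b (m ×ᴿ 1#) (n ×ᴿ 1#) ⟨
      (1# + m ×ᴿ 1#) - (1# + n ×ᴿ 1#)
                                ≈⟨ +-cong (1+× m 1#) (-‿cong (1+× n 1#)) ⟨
      suc m ×ᴿ 1# - suc n ×ᴿ 1#   ∎

    ι-pos◃ : ∀ n → ι (Sign.+ ◃ n) ≈ n ×ᴿ 1#
    ι-pos◃ zero    = ≈-refl
    ι-pos◃ (suc n) = ≈-refl

    ι-neg◃ : ∀ n → ι (Sign.- ◃ n) ≈ - (n ×ᴿ 1#)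
    ι-neg◃ zero    = sym ε⁻¹≈ε
    ι-neg◃ (suc n) = ≈-refl

  ι-+ : ∀ i j → ι (i ℤ.+ j) ≈ ι i + ι j
  ι-+ (+ m)    (+ n)    = ×-homo-+ 1# m n
  ι-+ (+ m)    -[1+ n ] = ι-⊖ m (suc n)
  ι-+ -[1+ m ] (+ n)    = trans (ι-⊖ n (suc m)) (+-comm _ _)
  ι-+ -[1+ m ] -[1+ n ] = begin
    - (suc (suc (m ℕ.+ n)) ×ᴿ 1#)      ≡⟨ cong (λ k → - (suc k ×ᴿ 1#)) (ℕ.+-suc m n) ⟨
    - ((suc m ℕ.+ suc n) ×ᴿ 1#)        ≈⟨ -‿cong (×-homo-+ 1# (suc m) (suc n)) ⟩
    - (suc m ×ᴿ 1# + suc n ×ᴿ 1#)       ≈⟨ ⁻¹-∙-comm _ _ ⟨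
    - (suc m ×ᴿ 1#) + - (suc n ×ᴿ 1#)   ∎

  ι-* : ∀ i j → ι (i ℤ.* j) ≈ ι i * ι j
  ι-* (+ m)    (+ n)    = trans (ι-pos◃ (m ℕ.* n)) (×1-homo-* m n)
  ι-* (+ m)    -[1+ n ] =
    trans (ι-neg◃ (m ℕ.* suc n)) (trans (-‿cong (×1-homo-* m (suc n))) (-‿distribʳ-* _ _))
  ι-* -[1+ m ] (+ n)    =
    trans (ι-neg◃ (suc m ℕ.* n)) (trans (-‿cong (×1-homo-* (suc m) n)) (-‿distribˡ-* _ _))
  ι-* -[1+ m ] -[1+ n ] = begin
    (suc m ℕ.* suc n) ×ᴿ 1#   ≈⟨ ×1-homo-* (suc m) (suc n) ⟩
    a * b                    ≈⟨ ⁻¹-involutive (a * b) ⟨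
    - - (a * b)              ≈⟨ -‿cong (-‿distribʳ-* a b) ⟩
    - (a * - b)              ≈⟨ -‿distribˡ-* a (- b) ⟩
    - a * - b                ∎
    where
      a b : Carrier
      a = suc m ×ᴿ 1#
      b = suc n ×ᴿ 1#

  ι-neg : ∀ i → ι (ℤ.- i) ≈ - ι i
  ι-neg (+ zero)  = sym ε⁻¹≈ε
  ι-neg (+ suc n) = ≈-refl
  ι-neg -[1+ n ]  = sym (⁻¹-involutive _)

  ι-homomorphism : ℤ.+-*-rawRing ACR.-Raw-AlmostCommutative⟶ ACR.fromCommutativeRing R
  ι-homomorphism = record
    { ⟦_⟧ = ι ; +-homo = ι-+ ; *-homo = ι-* ; -‿homo = ι-neg ; 0-homo = ≈-refl ; 1-homo = ≈-refl }

  open import Algebra.Solver.Ring ℤ.+-*-rawRing (ACR.fromCommutativeRing R) ι-homomorphism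
    (λ i j → Maybe.map (λ i≡j → reflexive (cong ι i≡j)) (dec⇒maybe (i ℤ.≟ j))) public

module PaleyDessins {q : ℕ} (F : FiniteField q) where
  open FiniteField F using (_⁻¹; 0≢1; ⁻¹-inverse; enumerate)

  commutativeRing : CommutativeRing 0ℓ 0ℓ
  commutativeRing = record { isCommutativeRing = FiniteField.isCommutativeRing F }

  open CommutativeRing commutativeRing hiding (refl; sym; trans)
  open import Algebra.Properties.Group +-group using (ε⁻¹≈ε; ⁻¹-involutive)
    renaming (x∙y⁻¹≈ε⇒x≈y to x-y≡0⇒x≡y)
  open IntegerCoefficientSolver commutativeRing
    using (solve; Polynomial; _:=_; _:+_; _:*_; _:-_; :-_; con)
  open AffineGroup F renaming (trans to translation)
  open Eq using (sym; trans; module ≡-Reasoning)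
  open ≡-Reasoning

  1ₚ : ∀ {k} → Polynomial k
  1ₚ = con (+ 1)

  -- Arithmetic of the field

  _≟_ : DecidableEquality Carrier
  a ≟ b = map′ from-injective (cong from) (from a Fin.≟ from b)
    where
      open Inverse enumerate using (to; from; strictlyInverseˡ)
      from-injective : from a ≡ from b → a ≡ b
      from-injective eq = begin
        a           ≡⟨ strictlyInverseˡ a ⟨
        to (from a) ≡⟨ cong to eq ⟩
        to (from b) ≡⟨ strictlyInverseˡ b ⟩
        b           ∎

  ⁻¹-inverseˡ : ∀ a → a ≢ 0# → a ⁻¹ * a ≡ 1#
  ⁻¹-inverseˡ a a≢0 = trans (*-comm (a ⁻¹) a) (⁻¹-inverse a a≢0)

  *-cancelˡ : ∀ a b c → a ≢ 0# → a * b ≡ a * c → b ≡ c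
  *-cancelˡ a b c a≢0 ab≡ac = begin
    b               ≡⟨ ⁻¹-cancel b ⟨
    a ⁻¹ * (a * b)  ≡⟨ cong (a ⁻¹ *_) ab≡ac ⟩
    a ⁻¹ * (a * c)  ≡⟨ ⁻¹-cancel c ⟩
    c               ∎
    where
      ⁻¹-cancel : ∀ d → a ⁻¹ * (a * d) ≡ d
      ⁻¹-cancel d = begin
        a ⁻¹ * (a * d)  ≡⟨ *-assoc (a ⁻¹) a d ⟨
        (a ⁻¹ * a) * d  ≡⟨ cong (_* d) (⁻¹-inverseˡ a a≢0) ⟩
        1# * d          ≡⟨ *-identityˡ d ⟩
        d               ∎

  *≡0⇒≡0 : ∀ a b → a ≢ 0# → a * b ≡ 0# → b ≡ 0#
  *≡0⇒≡0 a b a≢0 ab≡0 = *-cancelˡ a b 0# a≢0 (trans ab≡0 (sym (zeroʳ a)))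

  *-nonzero : ∀ a b → a ≢ 0# → b ≢ 0# → a * b ≢ 0#
  *-nonzero a b a≢0 b≢0 ab≡0 = b≢0 (*≡0⇒≡0 a b a≢0 ab≡0)

  ⁻¹-nonzero : ∀ a → a ≢ 0# → a ⁻¹ ≢ 0#
  ⁻¹-nonzero a a≢0 a⁻¹≡0 = 0≢1 (begin
    0#          ≡⟨ zeroʳ a ⟨
    a * 0#      ≡⟨ cong (a *_) a⁻¹≡0 ⟨
    a * a ⁻¹    ≡⟨ ⁻¹-inverse a a≢0 ⟩
    1#          ∎)

  x*x≡0⇒x≡0 : ∀ a → a * a ≡ 0# → a ≡ 0#
  x*x≡0⇒x≡0 a aa≡0 with a ≟ 0#
  ... | yes a≡0 = a≡0
  ... | no  a≢0 = ⊥-elim (a≢0 (*≡0⇒≡0 a a a≢0 aa≡0))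

  -x≡0⇒x≡0 : ∀ a → - a ≡ 0# → a ≡ 0#
  -x≡0⇒x≡0 a -a≡0 = trans (sym (⁻¹-involutive a)) (trans (cong -_ -a≡0) ε⁻¹≈ε)

  *≡1⇒⁻¹≡ : ∀ a b → a * b ≡ 1# → a ⁻¹ ≡ b
  *≡1⇒⁻¹≡ a b ab≡1 = *-cancelˡ a (a ⁻¹) b a≢0 (trans (⁻¹-inverse a a≢0) (sym ab≡1))
    where
      a≢0 : a ≢ 0#
      a≢0 a≡0 = 0≢1 (trans (sym (zeroˡ b)) (trans (cong (_* b) (sym a≡0)) ab≡1))

  pow-+ : ∀ a m k → pow a (m ℕ.+ k) ≡ pow a m * pow a k
  pow-+ a zero    k = sym (*-identityˡ _)
  pow-+ a (suc m) k = trans (cong (a *_) (pow-+ a m k)) (sym (*-assoc _ _ _))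

  pow-* : ∀ a m k → pow a (m ℕ.* k) ≡ pow (pow a m) k
  pow-* a m zero    = cong (pow a) (ℕ.*-zeroʳ m)
  pow-* a m (suc k) = begin
    pow a (m ℕ.* suc k)        ≡⟨ cong (pow a) (ℕ.*-suc m k) ⟩
    pow a (m ℕ.+ m ℕ.* k)      ≡⟨ pow-+ a m (m ℕ.* k) ⟩
    pow a m * pow a (m ℕ.* k)  ≡⟨ cong (pow a m *_) (pow-* a m k) ⟩
    pow a m * pow (pow a m) k  ∎

  pow-1# : ∀ k → pow 1# k ≡ 1#
  pow-1# zero    = refl
  pow-1# (suc k) = trans (*-identityˡ _) (pow-1# k)

  pow-nonzero : ∀ a k → a ≢ 0# → pow a k ≢ 0#
  pow-nonzero a zero    a≢0 = 0≢1 ∘ sym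
  pow-nonzero a (suc k) a≢0 = *-nonzero a (pow a k) a≢0 (pow-nonzero a k a≢0)

  -- Orders of roots of unity

  HasOrder⇒≢0 : ∀ x n → HasOrder x n → x ≢ 0#
  HasOrder⇒≢0 x zero    (() , _)
  HasOrder⇒≢0 x (suc n) (_ , xⁿ≡1 , _) x≡0 =
    0≢1 (trans (sym (zeroˡ (pow x n))) (trans (cong (_* pow x n) (sym x≡0)) xⁿ≡1))

  HasOrder-1⇒≡1 : ∀ x → HasOrder x 1 → x ≡ 1#
  HasOrder-1⇒≡1 x (_ , x¹≡1 , _) = trans (sym (*-identityʳ x)) x¹≡1

  HasOrder⇒≢1 : ∀ x n → HasOrder x n → 1 < n → x ≢ 1#
  HasOrder⇒≢1 x n (_ , _ , minimal) 1<n x≡1 = minimal 1 ℕ.≤-refl 1<n (trans (*-identityʳ x) x≡1)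

  x³≡1⇒order≡3 : ∀ x n → HasOrder x n → pow x 3 ≡ 1# → n ≢ 1 → n ≡ 3
  x³≡1⇒order≡3 x 0 (() , _) _ _
  x³≡1⇒order≡3 x 1 _ _ n≢1 = ⊥-elim (n≢1 refl)
  x³≡1⇒order≡3 x 2 (_ , x²≡1 , minimal) x³≡1 _ =
    ⊥-elim (minimal 1 ℕ.≤-refl ℕ.≤-refl (trans (sym (cong (x *_) x²≡1)) x³≡1))
  x³≡1⇒order≡3 x 3 _ _ _ = refl
  x³≡1⇒order≡3 x (suc (suc (suc (suc n)))) (_ , _ , minimal) x³≡1 _ =
    ⊥-elim (minimal 3 (s≤s z≤n) (s≤s (s≤s (s≤s (s≤s z≤n)))) x³≡1)

  -- Since 4c² + 2c = (2c+1)·2c, x⁴ · x^(2c) = 1 = x · x^(2c).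
  x^c²≡x⇒x^[2c+1]≡1⇒x³≡1 : ∀ x c → pow x (c ℕ.* c) ≡ x → pow x (suc (c ℕ.+ c)) ≡ 1# → pow x 3 ≡ 1#
  x^c²≡x⇒x^[2c+1]≡1⇒x³≡1 x c x^c²≡x x^[2c+1]≡1 = begin
    pow x 3                  ≡⟨ *-identityʳ (pow x 3) ⟨
    pow x 3 * 1#             ≡⟨ cong (pow x 3 *_) x^[2c+1]≡1 ⟨
    pow x 3 * (x * w)        ≡⟨ solve 2 (λ x w → (x :* (x :* (x :* 1ₚ))) :* (x :* w)
                                                := (x :* (x :* (x :* (x :* 1ₚ)))) :* w) refl x w ⟩
    pow x 4 * w              ≡⟨ cong (λ u → pow u 4 * w) x^c²≡x ⟨
    pow (pow x c²) 4 * w     ≡⟨ cong (_* w) (pow-* x c² 4) ⟨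
    pow x (c² ℕ.* 4) * w     ≡⟨ pow-+ x (c² ℕ.* 4) (c ℕ.+ c) ⟨
    pow x (c² ℕ.* 4 ℕ.+ (c ℕ.+ c))
                             ≡⟨ cong (pow x) (exponent c) ⟩
    pow x (suc (c ℕ.+ c) ℕ.* (c ℕ.+ c))
                             ≡⟨ pow-* x (suc (c ℕ.+ c)) (c ℕ.+ c) ⟩
    pow (pow x (suc (c ℕ.+ c))) (c ℕ.+ c)
                             ≡⟨ cong (λ u → pow u (c ℕ.+ c)) x^[2c+1]≡1 ⟩
    pow 1# (c ℕ.+ c)         ≡⟨ pow-1# (c ℕ.+ c) ⟩
    1#                       ∎
    where
      c² : ℕ
      c² = c ℕ.* c
      w : Carrier
      w = pow x (c ℕ.+ c)
      exponent : ∀ c → c ℕ.* c ℕ.* 4 ℕ.+ (c ℕ.+ c) ≡ suc (c ℕ.+ c) ℕ.* (c ℕ.+ c)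
      exponent = solve-∀

  HasOrder-3⇒x^[2c+1]≡1⇒c≡1 : ∀ x c → HasOrder x 3 → c < 3 → pow x (suc (c ℕ.+ c)) ≡ 1# → c ≡ 1
  HasOrder-3⇒x^[2c+1]≡1⇒c≡1 x 0 (_ , _ , minimal) _ x¹≡1 = ⊥-elim (minimal 1 ℕ.≤-refl (s≤s (s≤s z≤n)) x¹≡1)
  HasOrder-3⇒x^[2c+1]≡1⇒c≡1 x 1 _ _ _ = refl
  HasOrder-3⇒x^[2c+1]≡1⇒c≡1 x 2 (_ , x³≡1 , minimal) _ x⁵≡1 =
    ⊥-elim (minimal 2 (s≤s z≤n) ℕ.≤-refl (begin
      pow x 2               ≡⟨ *-identityʳ (pow x 2) ⟨
      pow x 2 * 1#          ≡⟨ cong (pow x 2 *_) x³≡1 ⟨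
      pow x 2 * pow x 3     ≡⟨ pow-+ x 2 3 ⟨
      pow x 5               ≡⟨ x⁵≡1 ⟩
      1#                    ∎))
  HasOrder-3⇒x^[2c+1]≡1⇒c≡1 x (suc (suc (suc c))) _ (s≤s (s≤s (s≤s ()))) _

  x³≡1⇒1+x+x²≡0 : ∀ x → pow x 3 ≡ 1# → x ≢ 1# → 1# + x + x * x ≡ 0#
  x³≡1⇒1+x+x²≡0 x x³≡1 x≢1 = *≡0⇒≡0 (x - 1#) (1# + x + x * x) (x≢1 ∘ x-y≡0⇒x≡y x 1#) (begin
    (x - 1#) * (1# + x + x * x)   ≡⟨ solve 1 (λ x → (x :- 1ₚ) :* (1ₚ :+ x :+ x :* x)
                                               := x :* (x :* (x :* 1ₚ)) :- 1ₚ) refl x ⟩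
    pow x 3 - 1#                  ≡⟨ cong (_- 1#) x³≡1 ⟩
    1# - 1#                       ≡⟨ -‿inverseʳ 1# ⟩
    0#                            ∎)

  -- The group G_S = T ⋊ ⟨ξ⟩ and its automorphisms

  identity : Aff
  identity = (1# , 0#)

  translations-commute : ∀ g h → proj₁ g ≡ 1# → proj₁ h ≡ 1# → g ∘ₐ h ≡ h ∘ₐ g
  translations-commute (_ , b) (_ , b') refl refl =
    cong (1# * 1# ,_) (solve 2 (λ b b' → 1ₚ :* b' :+ b := 1ₚ :* b :+ b') refl b b')

  idempotent⇒identity : ∀ g → proj₁ g ≢ 0# → g ∘ₐ g ≡ g → g ≡ identity
  idempotent⇒identity (a , β) a≢0 gg≡g = cong₂ _,_ a≡1 β≡0
    where
      a≡1 : a ≡ 1#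
      a≡1 = *-cancelˡ a a 1# a≢0 (trans (cong proj₁ gg≡g) (sym (*-identityʳ a)))
      β≡0 : β ≡ 0#
      β≡0 = begin
        β                    ≡⟨ solve 1 (λ β → β := (1ₚ :* β :+ β) :- β) refl β ⟩
        (1# * β + β) - β     ≡⟨ cong (λ u → (u * β + β) - β) a≡1 ⟨
        (a * β + β) - β      ≡⟨ cong (_- β) (cong proj₂ gg≡g) ⟩
        β - β                ≡⟨ -‿inverseʳ β ⟩
        0#                   ∎

  shift : Aff → Aff
  shift f = translation 1# ∘ₐ (f ∘ₐ translation (- 1#))

  -- shift (a , β) = (a , β + 1 - a), and it commutes with (a , β) only if (a - 1)² = 0.
  commutes-with-shift⇒translation : ∀ f → f ∘ₐ shift f ≡ shift f ∘ₐ f → proj₁ f ≡ 1#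
  commutes-with-shift⇒translation (a , β) commute =
    x-y≡0⇒x≡y a 1# (x*x≡0⇒x≡0 (a - 1#) (begin
      (a - 1#) * (a - 1#)   ≡⟨ solve 2 (λ a β → (a :- 1ₚ) :* (a :- 1ₚ)
                                  := ((1ₚ :* (a :* 1ₚ)) :* β :+ (1ₚ :* (a :* (:- 1ₚ) :+ β) :+ 1ₚ))
                                     :- (a :* (1ₚ :* (a :* (:- 1ₚ) :+ β) :+ 1ₚ) :+ β)) refl a β ⟩
      R - L                 ≡⟨ cong (λ u → R - u) (cong proj₂ commute) ⟩
      R - R                 ≡⟨ -‿inverseʳ R ⟩
      0#                    ∎))
    where
      L R : Carrier
      L = a * (1# * (a * - 1# + β) + 1#) + β
      R = (1# * (a * 1#)) * β + (1# * (a * - 1# + β) + 1#)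

  -- Conjugation by t ↦ l t + μ in AGL₁(q); it normalises every G_S.
  conjugation : Carrier → Carrier → Aff → Aff
  conjugation l μ g = (proj₁ g , l * proj₂ g + (1# - proj₁ g) * μ)

  module _ (ξ : Carrier) where

    translation∈G : ∀ b → InG ξ (translation b)
    translation∈G b = (0 , refl)

    lin∈G : InG ξ (lin ξ)
    lin∈G = (1 , *-identityʳ ξ)

    ∘ₐ-∈G : ∀ g h → InG ξ g → InG ξ h → InG ξ (g ∘ₐ h)
    ∘ₐ-∈G g h (i , ξⁱ≡g₁) (j , ξʲ≡h₁) = (i ℕ.+ j , trans (pow-+ ξ i j) (cong₂ _*_ ξⁱ≡g₁ ξʲ≡h₁))

    conjugation-isAutomorphism : ∀ l μ → l ≢ 0# → IsAutomorphism ξ (conjugation l μ)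
    conjugation-isAutomorphism l μ l≢0 = (λ _ g∈G → g∈G) , homomorphic , injective , surjective
      where
        homomorphic : ∀ g h → InG ξ g → InG ξ h →
                      conjugation l μ (g ∘ₐ h) ≡ conjugation l μ g ∘ₐ conjugation l μ h
        homomorphic (a , b) (a' , b') _ _ = cong (a * a' ,_)
          (solve 6 (λ l a b a' b' μ → l :* (a :* b' :+ b) :+ (1ₚ :- a :* a') :* μ
                                   := a :* (l :* b' :+ (1ₚ :- a') :* μ) :+ (l :* b :+ (1ₚ :- a) :* μ))
             refl l a b a' b' μ)
        injective : ∀ g h → InG ξ g → InG ξ h → conjugation l μ g ≡ conjugation l μ h → g ≡ h
        injective (a , b) (a' , b') _ _ eq with cong proj₁ eq
        ... | refl = cong (a ,_) (*-cancelˡ l b b' l≢0 (begin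
          l * b                     ≡⟨ solve 3 (λ l b k → l :* b := (l :* b :+ k) :- k) refl l b k ⟩
          (l * b + k) - k           ≡⟨ cong (_- k) (cong proj₂ eq) ⟩
          (l * b' + k) - k          ≡⟨ solve 3 (λ l b' k → (l :* b' :+ k) :- k := l :* b') refl l b' k ⟩
          l * b'                    ∎))
          where
            k : Carrier
            k = (1# - a) * μ
        surjective : ∀ h → InG ξ h → ∃ λ g → InG ξ g × conjugation l μ g ≡ h
        surjective (a , b) h∈G = (a , l ⁻¹ * (b - k)) , h∈G , cong (a ,_) (begin
          l * (l ⁻¹ * (b - k)) + k    ≡⟨ cong (_+ k) (*-assoc l (l ⁻¹) (b - k)) ⟨
          (l * l ⁻¹) * (b - k) + k    ≡⟨ cong (λ u → u * (b - k) + k) (⁻¹-inverse l l≢0) ⟩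
          1# * (b - k) + k            ≡⟨ solve 2 (λ b k → 1ₚ :* (b :- k) :+ k := b) refl b k ⟩
          b                           ∎)
          where
            k : Carrier
            k = (1# - a) * μ

    ∈G⇒linearPart≢0 : ξ ≢ 0# → ∀ g → InG ξ g → proj₁ g ≢ 0#
    ∈G⇒linearPart≢0 ξ≢0 g (i , ξⁱ≡g₁) g₁≡0 = pow-nonzero ξ i ξ≢0 (trans ξⁱ≡g₁ g₁≡0)

    module Automorphism (ξ≢0 : ξ ≢ 0#) (φ : Aff → Aff) (φ-aut : IsAutomorphism ξ φ) where
      private
        φ-∈G : ∀ g → InG ξ g → InG ξ (φ g)
        φ-∈G = proj₁ φ-aut
        φ-∘ₐ : ∀ g h → InG ξ g → InG ξ h → φ (g ∘ₐ h) ≡ φ g ∘ₐ φ h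
        φ-∘ₐ = proj₁ (proj₂ φ-aut)
        φ-injective : ∀ g h → InG ξ g → InG ξ h → φ g ≡ φ h → g ≡ h
        φ-injective = proj₁ (proj₂ (proj₂ φ-aut))
        φ-surjective : ∀ h → InG ξ h → ∃ λ g → InG ξ g × φ g ≡ h
        φ-surjective = proj₂ (proj₂ (proj₂ φ-aut))

      φ-identity : φ identity ≡ identity
      φ-identity = idempotent⇒identity (φ identity)
        (∈G⇒linearPart≢0 ξ≢0 (φ identity) (φ-∈G identity identity∈G))
        (begin
          φ identity ∘ₐ φ identity   ≡⟨ φ-∘ₐ identity identity identity∈G identity∈G ⟨
          φ (identity ∘ₐ identity)   ≡⟨ cong φ identity∘ₐidentity ⟩
          φ identity                 ∎)
        where
          identity∈G : InG ξ identity
          identity∈G = translation∈G 0#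
          identity∘ₐidentity : identity ∘ₐ identity ≡ identity
          identity∘ₐidentity = cong₂ _,_ (*-identityˡ 1#) (trans (+-identityʳ _) (zeroʳ 1#))

      -- With φ h = (t ↦ t + 1) and φ k = (t ↦ t - 1), the translation h g k commutes with g.
      φ-translation : ∀ b → proj₁ (φ (translation b)) ≡ 1#
      φ-translation b with φ-surjective (translation 1#) (translation∈G 1#)
                         | φ-surjective (translation (- 1#)) (translation∈G (- 1#))
      ... | (h , h∈G , φh≡τ) | (k , k∈G , φk≡τ⁻¹) =
        commutes-with-shift⇒translation (φ g) (begin
          φ g ∘ₐ shift (φ g)    ≡⟨ cong (φ g ∘ₐ_) φw≡shift ⟨
          φ g ∘ₐ φ w            ≡⟨ φ-∘ₐ g w g∈G w∈G ⟨
          φ (g ∘ₐ w)            ≡⟨ cong φ (translations-commute g w refl w₁≡1) ⟩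
          φ (w ∘ₐ g)            ≡⟨ φ-∘ₐ w g w∈G g∈G ⟩
          φ w ∘ₐ φ g            ≡⟨ cong (_∘ₐ φ g) φw≡shift ⟩
          shift (φ g) ∘ₐ φ g    ∎)
        where
          g w : Aff
          g = translation b
          w = h ∘ₐ (g ∘ₐ k)
          g∈G : InG ξ g
          g∈G = translation∈G b
          gk∈G : InG ξ (g ∘ₐ k)
          gk∈G = ∘ₐ-∈G g k g∈G k∈G
          w∈G : InG ξ w
          w∈G = ∘ₐ-∈G h (g ∘ₐ k) h∈G gk∈G
          hk≡identity : h ∘ₐ k ≡ identity
          hk≡identity = φ-injective (h ∘ₐ k) identity (∘ₐ-∈G h k h∈G k∈G) (translation∈G 0#) (begin
            φ (h ∘ₐ k)                            ≡⟨ φ-∘ₐ h k h∈G k∈G ⟩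
            φ h ∘ₐ φ k                            ≡⟨ cong₂ _∘ₐ_ φh≡τ φk≡τ⁻¹ ⟩
            translation 1# ∘ₐ translation (- 1#)  ≡⟨ cong₂ _,_ (*-identityˡ 1#) (solve 0 (1ₚ :* (:- 1ₚ) :+ 1ₚ := con (+ 0)) refl) ⟩
            identity                              ≡⟨ φ-identity ⟨
            φ identity                            ∎)
          w₁≡1 : proj₁ w ≡ 1#
          w₁≡1 = trans (cong (proj₁ h *_) (*-identityˡ (proj₁ k))) (cong proj₁ hk≡identity)
          φw≡shift : φ w ≡ shift (φ g)
          φw≡shift = trans (φ-∘ₐ h (g ∘ₐ k) h∈G gk∈G)
            (cong₂ _∘ₐ_ φh≡τ (trans (φ-∘ₐ g k g∈G k∈G) (cong (φ g ∘ₐ_) φk≡τ⁻¹)))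

      φ-linearPart-pow : ∀ k → proj₁ (φ (lin (pow ξ k))) ≡ pow (proj₁ (φ (lin ξ))) k
      φ-linearPart-pow zero    = cong proj₁ φ-identity
      φ-linearPart-pow (suc k) = begin
        proj₁ (φ (lin (pow ξ (suc k))))                 ≡⟨ cong (proj₁ ∘ φ) lin-suc ⟩
        proj₁ (φ (lin ξ ∘ₐ lin (pow ξ k)))              ≡⟨ cong proj₁ (φ-∘ₐ (lin ξ) (lin (pow ξ k)) lin∈G (k , refl)) ⟩
        proj₁ (φ (lin ξ)) * proj₁ (φ (lin (pow ξ k)))   ≡⟨ cong (proj₁ (φ (lin ξ)) *_) (φ-linearPart-pow k) ⟩
        proj₁ (φ (lin ξ)) * pow (proj₁ (φ (lin ξ))) k   ∎
        where
          lin-suc : lin (pow ξ (suc k)) ≡ lin ξ ∘ₐ lin (pow ξ k)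
          lin-suc = cong (pow ξ (suc k) ,_) (sym (trans (+-identityʳ _) (zeroʳ ξ)))

      φ-linearPart-colour : ∀ b k → proj₁ (φ (translation b ∘ₐ lin (pow ξ k))) ≡ pow (proj₁ (φ (lin ξ))) k
      φ-linearPart-colour b k = begin
        proj₁ (φ (translation b ∘ₐ lin (pow ξ k)))            ≡⟨ cong proj₁ (φ-∘ₐ _ _ (translation∈G b) (k , refl)) ⟩
        proj₁ (φ (translation b)) * proj₁ (φ (lin (pow ξ k)))  ≡⟨ cong (_* proj₁ (φ (lin (pow ξ k)))) (φ-translation b) ⟩
        1# * proj₁ (φ (lin (pow ξ k)))                         ≡⟨ *-identityˡ _ ⟩
        proj₁ (φ (lin (pow ξ k)))                              ≡⟨ φ-linearPart-pow k ⟩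
        pow (proj₁ (φ (lin ξ))) k                              ∎

    -- l carries the difference of translation parts of (P , Q) to that of (P' , Q'), and μ then
    -- moves P onto P' (solvable for μ because 1 - ξ ≠ 0).
    sameLinearPart⇒DessinIso : ξ ≢ 1# → ∀ P Q P' Q' →
      proj₁ P ≡ ξ → proj₁ Q ≡ ξ → proj₁ P' ≡ ξ → proj₁ Q' ≡ ξ →
      proj₂ P ≢ proj₂ Q → proj₂ P' ≢ proj₂ Q' → DessinIso ξ (P , Q) (P' , Q')
    sameLinearPart⇒DessinIso ξ≢1 (_ , p₁) (_ , p₂) (_ , q₁) (_ , q₂) refl refl refl refl p₁≢p₂ q₁≢q₂ =
      conjugation l μ , conjugation-isAutomorphism l μ l≢0 ,
      cong (ξ ,_) (begin
        l * p₁ + (1# - ξ) * μ       ≡⟨ cong (λ u → l * p₁ + u) [1-ξ]μ≡ν ⟩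
        l * p₁ + (q₁ - l * p₁)      ≡⟨ solve 2 (λ a b → a :+ (b :- a) := b) refl (l * p₁) q₁ ⟩
        q₁                          ∎) ,
      cong (ξ ,_) (begin
        l * p₂ + (1# - ξ) * μ       ≡⟨ cong (λ u → l * p₂ + u) [1-ξ]μ≡ν ⟩
        l * p₂ + (q₁ - l * p₁)      ≡⟨ solve 5 (λ q₁ q₂ p₁ p₂ δ →
                                          (q₂ :- q₁) :* δ :* p₂ :+ (q₁ :- (q₂ :- q₁) :* δ :* p₁)
                                          := (q₂ :- q₁) :* (δ :* (p₂ :- p₁)) :+ q₁) refl q₁ q₂ p₁ p₂ (Δp ⁻¹) ⟩
        Δq * (Δp ⁻¹ * Δp) + q₁      ≡⟨ cong (λ u → Δq * u + q₁) (⁻¹-inverseˡ Δp Δp≢0) ⟩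
        Δq * 1# + q₁                ≡⟨ solve 2 (λ q₁ q₂ → (q₂ :- q₁) :* 1ₚ :+ q₁ := q₂) refl q₁ q₂ ⟩
        q₂                          ∎)
      where
        Δp Δq l ν μ : Carrier
        Δp = p₂ - p₁
        Δq = q₂ - q₁
        Δp≢0 : Δp ≢ 0#
        Δp≢0 = p₁≢p₂ ∘ sym ∘ x-y≡0⇒x≡y p₂ p₁
        l = Δq * Δp ⁻¹
        ν = q₁ - l * p₁
        μ = (1# - ξ) ⁻¹ * ν
        l≢0 : l ≢ 0#
        l≢0 = *-nonzero Δq (Δp ⁻¹) (q₁≢q₂ ∘ sym ∘ x-y≡0⇒x≡y q₂ q₁) (⁻¹-nonzero Δp Δp≢0)
        [1-ξ]μ≡ν : (1# - ξ) * μ ≡ ν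
        [1-ξ]μ≡ν = begin
          (1# - ξ) * ((1# - ξ) ⁻¹ * ν)   ≡⟨ *-assoc _ _ _ ⟨
          ((1# - ξ) * (1# - ξ) ⁻¹) * ν   ≡⟨ cong (_* ν) (⁻¹-inverse _ (ξ≢1 ∘ sym ∘ x-y≡0⇒x≡y 1# ξ)) ⟩
          1# * ν                          ≡⟨ *-identityˡ ν ⟩
          ν                               ∎

  module ColouredDessin (n : ℕ) (x : Carrier) (x-order : HasOrder x n) (c : Fin n) (b : Carrier) where
    k : ℕ
    k = toℕ c
    X y Z : Aff
    X = lin x
    y = translation b ∘ₐ lin (pow x k)
    Z = invₐ (X ∘ₐ y)
    x≢0 : x ≢ 0#
    x≢0 = HasOrder⇒≢0 x n x-order

    invariant⇒n≡3∧c≡1 : InG x y → ¬ InSAff x y → InvariantUnderAll x y → n ≡ 3 × k ≡ 1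
    invariant⇒n≡3∧c≡1 y∈G y∉S (_ , (φ , φ-aut , φX≡y , φy≡X) , _ , (ψ , ψ-aut , ψX≡X , ψy≡Z) , _ , _) =
      n≡3 , HasOrder-3⇒x^[2c+1]≡1⇒c≡1 x k (subst (HasOrder x) n≡3 x-order) (subst (k <_) n≡3 (toℕ<n c)) x^[2c+1]≡1
      where
        module Φ = Automorphism x x≢0 φ φ-aut
        module Ψ = Automorphism x x≢0 ψ ψ-aut
        s u : Carrier
        s = pow x k
        u = x * proj₁ y
        x^c²≡x : pow x (k ℕ.* k) ≡ x
        x^c²≡x = begin
          pow x (k ℕ.* k)       ≡⟨ pow-* x k k ⟩
          pow s k               ≡⟨ cong (λ a → pow a k) (*-identityˡ s) ⟨
          pow (proj₁ y) k       ≡⟨ cong (λ g → pow (proj₁ g) k) φX≡y ⟨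
          pow (proj₁ (φ X)) k   ≡⟨ Φ.φ-linearPart-colour b k ⟨
          proj₁ (φ y)           ≡⟨ cong proj₁ φy≡X ⟩
          x                     ∎
        s≡u⁻¹ : s ≡ u ⁻¹
        s≡u⁻¹ = begin
          s                     ≡⟨ cong (λ g → pow (proj₁ g) k) ψX≡X ⟨
          pow (proj₁ (ψ X)) k   ≡⟨ Ψ.φ-linearPart-colour b k ⟨
          proj₁ (ψ y)           ≡⟨ cong proj₁ ψy≡Z ⟩
          u ⁻¹                  ∎
        x^[2c+1]≡1 : pow x (suc (k ℕ.+ k)) ≡ 1#
        x^[2c+1]≡1 = begin
          x * pow x (k ℕ.+ k)   ≡⟨ cong (x *_) (pow-+ x k k) ⟩
          x * (s * s)           ≡⟨ solve 2 (λ x s → x :* (s :* s) := x :* (1ₚ :* s) :* s) refl x s ⟩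
          u * s                 ≡⟨ cong (u *_) s≡u⁻¹ ⟩
          u * u ⁻¹              ≡⟨ ⁻¹-inverse u (*-nonzero x (proj₁ y) x≢0 (∈G⇒linearPart≢0 x x≢0 y y∈G)) ⟩
          1#                    ∎
        n≢1 : n ≢ 1
        n≢1 n≡1 = y∉S (y∈G , cong proj₂ (begin
          y             ≡⟨ φX≡y ⟨
          φ X           ≡⟨ cong (λ a → φ (a , 0#)) (HasOrder-1⇒≡1 x (subst (HasOrder x) n≡1 x-order)) ⟩
          φ identity    ≡⟨ Φ.φ-identity ⟩
          identity      ∎))
        n≡3 : n ≡ 3
        n≡3 = x³≡1⇒order≡3 x n x-order (x^c²≡x⇒x^[2c+1]≡1⇒x³≡1 x k x^c²≡x x^[2c+1]≡1) n≢1

    n≡3∧c≡1⇒invariant : InG x y → ¬ InSAff x y → n ≡ 3 × k ≡ 1 → InvariantUnderAll x y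
    n≡3∧c≡1⇒invariant y∈G y∉S (n≡3 , k≡1) =
      iso X y refl y₁≡x X₂≢y₂ , iso y X y₁≡x refl (X₂≢y₂ ∘ sym) ,
      iso Z y Z₁≡x y₁≡x (y₂≢Z₂ ∘ sym) , iso X Z refl Z₁≡x X₂≢Z₂ ,
      iso y Z y₁≡x Z₁≡x y₂≢Z₂ , iso Z X Z₁≡x refl (X₂≢Z₂ ∘ sym)
      where
        x³≡1 : pow x 3 ≡ 1#
        x³≡1 = proj₁ (proj₂ (subst (HasOrder x) n≡3 x-order))
        x≢1 : x ≢ 1#
        x≢1 = HasOrder⇒≢1 x n x-order (subst (1 <_) (sym n≡3) (s≤s (s≤s z≤n)))
        y₂ : Carrier
        y₂ = proj₂ y
        y₂≢0 : y₂ ≢ 0#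
        y₂≢0 y₂≡0 = y∉S (y∈G , y₂≡0)
        y₁≡x : proj₁ y ≡ x
        y₁≡x = trans (*-identityˡ (pow x k)) (trans (cong (pow x) k≡1) (*-identityʳ x))
        Z₁≡x : proj₁ Z ≡ x
        Z₁≡x = *≡1⇒⁻¹≡ (x * proj₁ y) x (begin
          x * proj₁ y * x   ≡⟨ cong (λ a → x * a * x) y₁≡x ⟩
          x * x * x         ≡⟨ solve 1 (λ x → x :* x :* x := x :* (x :* (x :* 1ₚ))) refl x ⟩
          pow x 3           ≡⟨ x³≡1 ⟩
          1#                ∎)
        Z₂≡ : proj₂ Z ≡ - (x * x * y₂)
        Z₂≡ = begin
          - ((x * proj₁ y) ⁻¹ * (x * y₂ + 0#))   ≡⟨ cong (λ a → - (a * (x * y₂ + 0#))) Z₁≡x ⟩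
          - (x * (x * y₂ + 0#))                  ≡⟨ solve 2 (λ x y₂ → :- (x :* (x :* y₂ :+ con (+ 0)))
                                                                 := :- (x :* x :* y₂)) refl x y₂ ⟩
          - (x * x * y₂)                         ∎
        X₂≢y₂ : 0# ≢ y₂
        X₂≢y₂ = y₂≢0 ∘ sym
        X₂≢Z₂ : 0# ≢ proj₂ Z
        X₂≢Z₂ 0≡Z₂ = y₂≢0 (*≡0⇒≡0 (x * x) y₂ (*-nonzero x x x≢0 x≢0)
          (-x≡0⇒x≡0 (x * x * y₂) (trans (sym Z₂≡) (sym 0≡Z₂))))
        y₂≢Z₂ : y₂ ≢ proj₂ Z
        y₂≢Z₂ y₂≡Z₂ = x≢0 (begin
          x                                   ≡⟨ solve 1 (λ x → x := (1ₚ :+ x :+ x :* x) :- (1ₚ :+ x :* x)) refl x ⟩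
          (1# + x + x * x) - (1# + x * x)     ≡⟨ cong₂ _-_ (x³≡1⇒1+x+x²≡0 x x³≡1 x≢1) 1+x²≡0 ⟩
          0# - 0#                             ≡⟨ -‿inverseʳ 0# ⟩
          0#                                  ∎)
          where
            1+x²≡0 : 1# + x * x ≡ 0#
            1+x²≡0 = *≡0⇒≡0 y₂ (1# + x * x) y₂≢0 (begin
              y₂ * (1# + x * x)        ≡⟨ solve 2 (λ x y₂ → y₂ :* (1ₚ :+ x :* x) := y₂ :+ x :* x :* y₂) refl x y₂ ⟩
              y₂ + x * x * y₂          ≡⟨ cong (_+ x * x * y₂) (trans y₂≡Z₂ Z₂≡) ⟩
              - (x * x * y₂) + x * x * y₂   ≡⟨ -‿inverseˡ _ ⟩
              0#                       ∎)
        iso : ∀ P' Q' → proj₁ P' ≡ x → proj₁ Q' ≡ x → proj₂ P' ≢ proj₂ Q' → DessinIso x (X , y) (P' , Q')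
        iso P' Q' P'₁≡x Q'₁≡x = sameLinearPart⇒DessinIso x x≢1 X y P' Q' refl y₁≡x P'₁≡x Q'₁≡x X₂≢y₂

corollary5p2 : (p d n : ℕ) → Prime p → 1 ≤ d → AdmissibleParams n p d →
    (F : FiniteField (p ^ d)) →
    (x : FiniteField.Carrier F) → AffineGroup.HasOrder F x n →
    (y : AffineGroup.Aff F) → AffineGroup.InG F x y → ¬ AffineGroup.InSAff F x y →
    (c : Fin n) → AffineGroup.ColourConstant F x y c →
    AffineGroup.InvariantUnderAll F x y ⇔ (n ≡ 3 × toℕ c ≡ 1)
corollary5p2 p d n _ _ _ F x x-order _ y∈G y∉S c (b , refl) =
  mk⇔ (invariant⇒n≡3∧c≡1 y∈G y∉S) (n≡3∧c≡1⇒invariant y∈G y∉S)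
  where open PaleyDessins.ColouredDessin F n x x-order c b
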